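{- Let $n\ge1$ be an integer and $\sigma$ a substitution over $n$ variables in classical (Boolean) logic. Then $\sigma$ is neither exact nor mixing. Moreover the following are equivalent: (i) $\sigma$ is ergodic; (ii) $\sigma$ is generic; (iii) $\sigma$ is minimal; (iv) the dual map $S$ permutes cyclically the $2^n$ points of $X$ (i.e. acts as a single cycle of length $2^n$); (v) $\sigma$ is invertible and the group it generates has order $2^n$.
   Context: Let $F_n$ be the free Boolean algebra on generators $x_1,\dots,x_n$ (Boolean functions $\{0,1\}^n\to\{0,1\}$). A substitution over $n$ variables is an endomorphism $\sigma$ of $F_n$; it is invertible if it is an automorphism. Let $X$ be the set of proper prime filters of $F_n$ (identified with $\{0,1\}^n$ via $p\mapsto\{t: t(p)=1\}$, a discrete space), with $\lambda$ the uniform probability measure (each point has mass $2^{ -n}$). The dual map is $S:X\to X$, $S(\mathfrak p)=\sigma^{ -1}[\mathfrak p]$. A Borel probability measure $\mu$ on $X$ is algebraically equivalent to $\lambda$ if $\mu(A)=\lambda(R^{ -1}[A])$ for all $A$, where $R$ is the dual of some automorphism of $F_n$. $\sigma$ is minimal if every point of $X$ has a dense $S$-orbit $\{S^k(x):k\ge0\}$; generic if for every $\mu$ algebraically equivalent to $\lambda$ the set of points with dense $S$-orbit has $\mu$-measure $1$. $\sigma$ is ergodic (resp. mixing, exact) if there is a probability measure $\mu$ on $X$ such that every measure algebraically equivalent to $\lambda$ is absolutely continuous w.r.t. $\mu$, $S$ preserves $\mu$ ($\mu(S^{ -1}A)=\mu(A)$), and $(X,\mu,S)$ is ergodic (invariant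 sets have measure $0$ or $1$), resp. mixing ($\lim_k\mu(A\cap S^{ -k}B)=\mu(A)\mu(B)$ for all $A,B$), resp. exact ($\bigcap_{k\ge0}S^{ -k}\mathcal{B}$ contains only sets of measure $0$ or $1$, $\mathcal B$ the Borel $\sigma$-algebra).
   Formalization: The probability measure μ witnessing that σ is ergodic, mixing or exact has rational point masses. -}

module Defs where

open import Data.Bool using (Bool; true; false; _∧_; _∨_; not; if_then_else_)
open import Data.Nat as ℕ using (ℕ; zero; suc; _^_)
open import Data.Nat.Properties using (m^n≢0)
open import Data.Integer using (+_)
open import Data.Fin using (Fin)
open import Data.Vec using (Vec; []; _∷_; lookup)
open import Data.List using (List; []; _∷_; _++_; map)
open import Data.Rational using (ℚ; 0ℚ; 1ℚ; _+_; _*_; _-_; ∣_∣; _≤_; _<_; _/_)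
open import Data.Product using (Σ; _×_; ∃; ∃-syntax)
open import Data.Sum using (_⊎_)
open import Relation.Binary.PropositionalEquality using (_≡_)
open import Relation.Nullary using (¬_)
open import Function.Bundles using (_⇔_)

-- The free Boolean algebra F_n: Boolean functions {0,1}^n → {0,1},
-- with pointwise equality.

Point : ℕ → Set
Point n = Vec Bool n

BF : ℕ → Set
BF n = Point n → Bool

_≈F_ : ∀ {n} → BF n → BF n → Set
s ≈F t = ∀ p → s p ≡ t p

gen : ∀ {n} → Fin n → BF n
gen i p = lookup p i

-- A substitution over n variables: an endomorphism of F_n.
record Subst (n : ℕ) : Set where
  field
    app   : BF n → BF n
    cong  : ∀ {s t} → s ≈F t → app s ≈F app t
    ∧-hom : ∀ s t → app (λ q → s q ∧ t q) ≈F (λ q → app s q ∧ app t q)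
    ∨-hom : ∀ s t → app (λ q → s q ∨ t q) ≈F (λ q → app s q ∨ app t q)
    ¬-hom : ∀ s → app (λ q → not (s q)) ≈F (λ q → not (app s q))
    0-hom : app (λ _ → false) ≈F (λ _ → false)
    1-hom : app (λ _ → true) ≈F (λ _ → true)
open Subst public

_≈S_ : ∀ {n} → Subst n → Subst n → Set
σ ≈S τ = ∀ t → app σ t ≈F app τ t

idS : ∀ {n} → Subst n
idS = record
  { app = λ t → t ; cong = λ e → e
  ; ∧-hom = λ _ _ _ → Relation.Binary.PropositionalEquality.refl
  ; ∨-hom = λ _ _ _ → Relation.Binary.PropositionalEquality.refl
  ; ¬-hom = λ _ _ → Relation.Binary.PropositionalEquality.refl
  ; 0-hom = λ _ → Relation.Binary.PropositionalEquality.refl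
  ; 1-hom = λ _ → Relation.Binary.PropositionalEquality.refl }

_∘S_ : ∀ {n} → Subst n → Subst n → Subst n
σ ∘S τ = record
  { app = λ t → app σ (app τ t)
  ; cong = λ e → cong σ (cong τ e)
  ; ∧-hom = λ s t p → trans (cong σ (∧-hom τ s t) p) (∧-hom σ (app τ s) (app τ t) p)
  ; ∨-hom = λ s t p → trans (cong σ (∨-hom τ s t) p) (∨-hom σ (app τ s) (app τ t) p)
  ; ¬-hom = λ s p → trans (cong σ (¬-hom τ s) p) (¬-hom σ (app τ s) p)
  ; 0-hom = λ p → trans (cong σ (0-hom τ) p) (0-hom σ p)
  ; 1-hom = λ p → trans (cong σ (1-hom τ) p) (1-hom σ p) }
  where open Relation.Binary.PropositionalEquality using (trans)

_^S_ : ∀ {n} → Subst n → ℕ → Subst n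
σ ^S zero  = idS
σ ^S suc k = σ ∘S (σ ^S k)

Invertible : ∀ {n} → Subst n → Set
Invertible {n} σ = Σ (Subst n) λ τ → ((τ ∘S σ) ≈S idS) × ((σ ∘S τ) ≈S idS)

GeneratedGroupOrder : ∀ {n} → Subst n → ℕ → Set
GeneratedGroupOrder σ m =
  ((σ ^S m) ≈S idS) × (∀ k → 0 ℕ.< k → k ℕ.< m → ¬ ((σ ^S k) ≈S idS))

-- The dual space X of proper prime filters, identified with Point n via
-- p ↦ {t : t(p) = 1}.  S is the dual map of σ, S(𝔭) = σ⁻¹[𝔭]:
-- under the identification, t ∈ S(p) iff σ(t) ∈ p, i.e. t(S p) = σ(t)(p).

IsDual : ∀ {n} → Subst n → (Point n → Point n) → Set
IsDual {n} σ S = ∀ (p : Point n) (t : BF n) → t (S p) ≡ app σ t p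

iter : ∀ {A : Set} → (A → A) → ℕ → A → A
iter f zero x    = x
iter f (suc k) x = f (iter f k x)

-- Measures on the finite discrete space X (all subsets are Borel).
-- Subsets are represented as Boolean predicates.

allPoints : (n : ℕ) → List (Point n)
allPoints zero    = [] ∷ []
allPoints (suc n) = map (true ∷_) (allPoints n) ++ map (false ∷_) (allPoints n)

Subset : ℕ → Set
Subset n = Point n → Bool

sumℚ : List ℚ → ℚ
sumℚ []       = 0ℚ
sumℚ (x ∷ xs) = x + sumℚ xs

record ProbMeasure (n : ℕ) : Set where
  field
    mass    : Point n → ℚ
    nonneg  : ∀ p → 0ℚ ≤ mass p
    total   : sumℚ (map mass (allPoints n)) ≡ 1ℚ
open ProbMeasure public

measureBy : ∀ {n} → (Point n → ℚ) → Subset n → ℚ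
measureBy {n} m A = sumℚ (map (λ p → if A p then m p else 0ℚ) (allPoints n))

meas : ∀ {n} → ProbMeasure n → Subset n → ℚ
meas μ A = measureBy (mass μ) A

λmeas : ∀ {n} → Subset n → ℚ
λmeas {n} A = measureBy (λ _ → _/_ (+ 1) (2 ^ n) {{m^n≢0 2 n}}) A

preimage : ∀ {n} → (Point n → Point n) → Subset n → Subset n
preimage f A p = A (f p)

_∩_ : ∀ {n} → Subset n → Subset n → Subset n
(A ∩ B) p = A p ∧ B p

-- μ(P) = r for an arbitrary (Set-valued) subset P: P is given by a
-- Boolean predicate of measure r
MeasureIs : ∀ {n} → ProbMeasure n → (Point n → Set) → ℚ → Set
MeasureIs {n} μ P r =
  Σ (Subset n) λ B → (∀ p → (B p ≡ true) ⇔ P p) × (meas μ B ≡ r)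

AlgEquivλ : ∀ {n} → ProbMeasure n → Set
AlgEquivλ {n} μ =
  Σ (Subst n) λ ρ → Invertible ρ × Σ (Point n → Point n) λ R →
    IsDual ρ R × (∀ A → meas μ A ≡ λmeas (preimage R A))

AbsCont : ∀ {n} → ProbMeasure n → ProbMeasure n → Set
AbsCont ν μ = ∀ A → meas μ A ≡ 0ℚ → meas ν A ≡ 0ℚ

Preserves : ∀ {n} → (Point n → Point n) → ProbMeasure n → Set
Preserves S μ = ∀ A → meas μ (preimage S A) ≡ meas μ A

ErgodicFor : ∀ {n} → (Point n → Point n) → ProbMeasure n → Set
ErgodicFor S μ =
  ∀ A → (∀ p → preimage S A p ≡ A p) → (meas μ A ≡ 0ℚ) ⊎ (meas μ A ≡ 1ℚ)

Converges : (ℕ → ℚ) → ℚ → Set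
Converges a b = ∀ ε → 0ℚ < ε → ∃[ N ] ∀ k → N ℕ.≤ k → ∣ a k - b ∣ < ε

MixingFor : ∀ {n} → (Point n → Point n) → ProbMeasure n → Set
MixingFor S μ = ∀ A B →
  Converges (λ k → meas μ (A ∩ preimage (iter S k) B)) (meas μ A * meas μ B)

InTailAlgebra : ∀ {n} → (Point n → Point n) → Subset n → Set
InTailAlgebra S A = ∀ k → Σ (Subset _) λ B → ∀ p → A p ≡ preimage (iter S k) B p

ExactFor : ∀ {n} → (Point n → Point n) → ProbMeasure n → Set
ExactFor S μ = ∀ A → InTailAlgebra S A → (meas μ A ≡ 0ℚ) ⊎ (meas μ A ≡ 1ℚ)

WithAdmissibleMeasure : ∀ {n} → (Point n → Point n)
  → ((Point n → Point n) → ProbMeasure n → Set) → Set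
WithAdmissibleMeasure {n} S Prop =
  Σ (ProbMeasure n) λ μ →
    (∀ ν → AlgEquivλ ν → AbsCont ν μ) × Preserves S μ × Prop S μ

Ergodic Mixing Exact : ∀ {n} → (Point n → Point n) → Set
Ergodic S = WithAdmissibleMeasure S ErgodicFor
Mixing  S = WithAdmissibleMeasure S MixingFor
Exact   S = WithAdmissibleMeasure S ExactFor

-- dense orbit in the discrete space X: the orbit is all of X
DenseOrbit : ∀ {n} → (Point n → Point n) → Point n → Set
DenseOrbit {n} S x = ∀ (y : Point n) → ∃[ k ] iter S k x ≡ y

Minimal : ∀ {n} → (Point n → Point n) → Set
Minimal S = ∀ x → DenseOrbit S x

Generic : ∀ {n} → (Point n → Point n) → Set
Generic S = ∀ μ → AlgEquivλ μ → MeasureIs μ (DenseOrbit S) 1ℚ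

SingleCycle : ∀ {n} → (Point n → Point n) → Set
SingleCycle {n} S = Σ (Point n) λ x →
  (∀ i j → i ℕ.< 2 ^ n → j ℕ.< 2 ^ n → iter S i x ≡ iter S j x → i ≡ j)
  × (iter S (2 ^ n) x ≡ x)

module Submission where

-- X is the finite set of 2^n points, and duality turns σᵏ ≈ id into Sᵏ = id, so everything
-- is a statement about the map S on 2^n points. An S-invariant measure dominating the
-- uniform measure λ charges every point, hence S is a bijection and every singleton {p}
-- has measure strictly between 0 and 1 (as n ≥ 1). Then {p} = S⁻ᵏ{Sᵏ p} lies in the tail
-- σ-algebra, so S is not exact, and μ({p} ∩ S⁻ᵏ{p}) only takes the values μ{p} and 0,
-- neither of which is μ{p}², so S is not mixing. The orbit of a point is an invariant set
-- of positive measure, so ergodicity (and, through λ, genericity) forces all orbits to be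
-- dense, i.e. minimality; conversely invariant sets of a minimal map are constant. Minimality
-- means that one orbit runs through all 2^n points before returning: a single cycle. Finally,
-- if S^(2^n) = id but S^(2^(n-1)) ≠ id, some point x is moved by S^(2^(n-1)); for a period
-- d < 2^n of x, gcd d 2^n would be a period of x dividing 2^(n-1), so x lies on a 2^n-cycle.

open import Defs hiding (cong)

open import Algebra.Bundles using (CommutativeMonoid)
import Algebra.Properties.CommutativeSemigroup as CommutativeSemigroupProperties
import Algebra.Properties.Group as GroupProperties
open import Data.Bool as Bool using (true; false; not; _∧_; if_then_else_)
open import Data.Bool.Properties as Bool using (not-¬)
open import Data.Empty using (⊥-elim; ⊥-elim-irr)
open import Data.Fin as Fin using (Fin; toℕ; punchOut)
open import Data.Fin.Properties as Fin using (punchOut-injective)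
open import Data.Integer using (+_)
import Data.Integer as ℤ
import Data.Integer.Properties as ℤ
open import Data.Integer.Tactic.RingSolver using (solve-∀)
open import Data.List using (List; []; _∷_; _++_; map; foldr)
open import Data.List.Membership.Propositional using (_∈_)
open import Data.List.Membership.Propositional.Properties using (∈-map⁺; ∈-map⁻; ∈-++⁺ˡ; ∈-++⁺ʳ)
open import Data.List.Membership.Propositional.Properties.WithK using (unique∧set⇒bag)
open import Data.List.Properties using (map-++; map-∘; map-cong)
open import Data.List.Relation.Binary.BagAndSetEquality using (∼bag⇒↭)
open import Data.List.Relation.Binary.Permutation.Propositional using (_↭_; ↭-sym; ↭⇒↭ₛ)
open import Data.List.Relation.Binary.Permutation.Propositional.Properties using () renaming (map⁺ to ↭-map⁺)
open import Data.List.Relation.Binary.Permutation.Setoid.Properties using (foldr-commMonoid)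
import Data.List.Relation.Unary.All as All
import Data.List.Relation.Unary.AllPairs as AllPairs
open import Data.List.Relation.Unary.Any using (here; there)
open import Data.List.Relation.Unary.Unique.Propositional using (Unique)
import Data.List.Relation.Unary.Unique.Propositional.Properties as Unique
open import Data.Nat as ℕ using (ℕ; zero; suc; _+_; _*_; _∸_; _^_; _≤_; _<_; NonZero)
open import Data.Nat.Coprimality using (Coprime; coprime-divisor)
open import Data.Nat.Divisibility using (_∣_; _∣?_; divides; ∣⇒≤; ∣1⇒≡1; *-cancelʳ-∣; *-monoˡ-∣)
open import Data.Nat.DivMod using (_divMod_; result)
open import Data.Nat.GCD using (gcd; gcd-GCD; gcd[m,n]∣m; gcd[m,n]∣n; module Bézout)
open import Data.Nat.Primality using (irreducible[2])
import Data.Nat.Properties as ℕ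
open import Data.Product using (_×_; _,_; proj₁; proj₂; ∃; ∃₂; uncurry)
open import Data.Product.Function.NonDependent.Propositional using (_×-↔_)
open import Data.Rational as ℚ using (ℚ; 0ℚ; 1ℚ; _/_; toℚᵘ; fromℚᵘ)
import Data.Rational.Properties as ℚ
open import Data.Rational.Unnormalised as ℚᵘ using (mkℚᵘ; *≡*)
import Data.Rational.Unnormalised.Properties as ℚᵘ
open import Data.Sum using (_⊎_; inj₁; inj₂; [_,_]′)
open import Data.Vec using ([]; _∷_; uncons; replicate)
open import Data.Vec.Properties using (∷-injectiveˡ; ∷-injectiveʳ; ≡-dec)
open import Function using (id; _∘_; case_of_; _↔_; _⇔_; mk⇔; mk↔ₛ′; Equivalence; Inverse; Injection)
open import Function.Definitions using (Injective; StrictlySurjective)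
open import Function.Properties.Inverse using (↔-refl; ↔-sym; ↔-trans; ↔⇒↣)
open import Relation.Binary.Definitions using (DecidableEquality; tri<; tri≈; tri>)
open import Relation.Binary.PropositionalEquality
open import Relation.Nullary using (¬_; Dec; yes; no; does; ¬?; contradiction)
import Relation.Nullary.Decidable as Dec
open import Relation.Nullary.Decidable using (decidable-stable; dec-true; dec-false; does-⇔)
open import Relation.Unary using (Decidable)

-- Finite sets

Fin-injective⇒surjective : ∀ {m} {f : Fin m → Fin m} → Injective _≡_ _≡_ f → StrictlySurjective _≡_ f
Fin-injective⇒surjective {suc m} {f} f-injective y with Fin.any? (λ x → f x Fin.≟ y)
... | yes hit  = hit
... | no  miss = contradiction (Fin.injective⇒≤ punched-injective) ℕ.1+n≰n
  where
  punched : Fin (suc m) → Fin m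
  punched x = punchOut {i = y} (λ y≡fx → miss (x , sym y≡fx))

  punched-injective : Injective _≡_ _≡_ punched
  punched-injective eq = f-injective (punchOut-injective {i = y} _ _ eq)

module _ {A B : Set} {f : A → B} (f-surjective : StrictlySurjective _≡_ f) where

  section : B → A
  section y = proj₁ (f-surjective y)

  section-inverse : ∀ y → f (section y) ≡ y
  section-inverse y = proj₂ (f-surjective y)

  section-injective : Injective _≡_ _≡_ section
  section-injective {y} {y′} eq =
    trans (sym (section-inverse y)) (trans (cong f eq) (section-inverse y′))

module Finite {A : Set} {m : ℕ} (enum : A ↔ Fin m) where

  open Inverse enum using (to; from; strictlyInverseʳ)

  to-injective : Injective _≡_ _≡_ to
  to-injective = Injection.injective (↔⇒↣ enum)

  from-injective : Injective _≡_ _≡_ from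
  from-injective = Injection.injective (↔⇒↣ (↔-sym enum))

  any? : {P : A → Set} → Decidable P → Dec (∃ P)
  any? {P} P? = Dec.map′ (λ (i , Pi) → from i , Pi)
                         (λ (x , Px) → to x , subst P (sym (strictlyInverseʳ x)) Px)
                         (Fin.any? (P? ∘ from))

  ¬∀⇒∃¬ : {P : A → Set} → Decidable P → ¬ (∀ x → P x) → ∃ λ x → ¬ P x
  ¬∀⇒∃¬ P? ¬all with any? (¬? ∘ P?)
  ... | yes counterexample = counterexample
  ... | no  none = contradiction (λ x → decidable-stable (P? x) (λ ¬Px → none (x , ¬Px))) ¬all

  pigeonhole : (f : ℕ → A) → ∃₂ λ i j → i < j × f i ≡ f j
  pigeonhole f with i , j , i<j , eq ← Fin.pigeonhole (ℕ.n<1+n m) (to ∘ f ∘ toℕ) =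
    toℕ i , toℕ j , i<j , to-injective eq

  injective⇒surjective : ∀ {B : Set} → B ↔ Fin m → (f : B → A) →
                         Injective _≡_ _≡_ f → StrictlySurjective _≡_ f
  injective⇒surjective B↔Fin f f-injective y =
    let i , eq = Fin-injective⇒surjective f′-injective (to y) in fromB i , to-injective eq
    where
    open Inverse B↔Fin using () renaming (from to fromB)
    f′-injective : Injective _≡_ _≡_ (to ∘ f ∘ fromB)
    f′-injective = Injection.injective (↔⇒↣ (↔-sym B↔Fin)) ∘ f-injective ∘ to-injective

  surjective⇒injective : (f : A → A) → StrictlySurjective _≡_ f → Injective _≡_ _≡_ f
  surjective⇒injective f f-surjective {a} {b} fa≡fb =
    trans (sym (retraction a)) (trans (cong (section f-surjective) fa≡fb) (retraction b))
    where
    retraction : ∀ a → section f-surjective (f a) ≡ a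
    retraction a with a′ , refl ← injective⇒surjective enum _ (section-injective f-surjective) a =
      cong (section f-surjective) (section-inverse f-surjective a′)

  surjective⇒≤ : ∀ {d} (f : Fin d → A) → StrictlySurjective _≡_ f → m ≤ d
  surjective⇒≤ f f-surjective = Fin.injective⇒≤ (from-injective ∘ section-injective f-surjective)

∈-allPoints : ∀ {n} (p : Point n) → p ∈ allPoints n
∈-allPoints []          = here refl
∈-allPoints (true ∷ p)  = ∈-++⁺ˡ (∈-map⁺ (true ∷_) (∈-allPoints p))
∈-allPoints (false ∷ p) = ∈-++⁺ʳ _ (∈-map⁺ (false ∷_) (∈-allPoints p))

allPoints-unique : ∀ n → Unique (allPoints n)
allPoints-unique zero    = All.[] AllPairs.∷ AllPairs.[]
allPoints-unique (suc n) =
  Unique.++⁺ (Unique.map⁺ ∷-injectiveʳ (allPoints-unique n))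
             (Unique.map⁺ ∷-injectiveʳ (allPoints-unique n))
             λ (v∈true , v∈false) → case ∈-map⁻ _ v∈true , ∈-map⁻ _ v∈false of λ where
               ((_ , _ , refl) , (_ , _ , ()))

Point↔Fin : ∀ n → Point n ↔ Fin (2 ^ n)
Point↔Fin zero    =
  mk↔ₛ′ (λ _ → Fin.zero) (λ _ → []) (λ { Fin.zero → refl; (Fin.suc ()) }) (λ { [] → refl })
Point↔Fin (suc n) =
  ↔-trans (mk↔ₛ′ uncons (uncurry _∷_) (λ _ → refl) (λ { (_ ∷ _) → refl }))
          (↔-trans (↔-sym Fin.2↔Bool ×-↔ Point↔Fin n) (↔-sym Fin.*↔×))

module _ {n : ℕ} where
  open Finite (Point↔Fin n) public

_≟_ : ∀ {n} → DecidableEquality (Point n)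
_≟_ = ≡-dec Bool._≟_

does-true⇒ : ∀ {P : Set} (P? : Dec P) → does P? ≡ true → P
does-true⇒ (yes p) _ = p

⁅_⁆ : ∀ {n} → Point n → Subset n
⁅ p ⁆ q = does (p ≟ q)

⁅⁆-self : ∀ {n} (p : Point n) → ⁅ p ⁆ p ≡ true
⁅⁆-self p = dec-true (p ≟ p) refl

⁅⁆-true⇒≡ : ∀ {n} {p q : Point n} → ⁅ p ⁆ q ≡ true → p ≡ q
⁅⁆-true⇒≡ {p = p} {q} = does-true⇒ (p ≟ q)

⁅⁆-∩ : ∀ {n} (p : Point n) (B : Subset n) q → (⁅ p ⁆ ∩ B) q ≡ ⁅ p ⁆ q ∧ B p
⁅⁆-∩ p B q with p ≟ q
... | yes refl = refl
... | no  _    = refl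

⁅⁆-image : ∀ {n} {f : Point n → Point n} → Injective _≡_ _≡_ f →
           ∀ p q → ⁅ p ⁆ q ≡ ⁅ f p ⁆ (f q)
⁅⁆-image {f = f} f-injective p q = does-⇔ (mk⇔ (cong f) f-injective) (p ≟ q) (f p ≟ f q)

⁅⁆-proper : ∀ {n} → 1 ≤ n → (p : Point n) → ∃ λ q → ⁅ p ⁆ q ≡ false
⁅⁆-proper {suc _} _ (b ∷ v) =
  not b ∷ v , dec-false ((b ∷ v) ≟ (not b ∷ v)) (not-¬ refl ∘ ∷-injectiveˡ)

-- Iterates and periods

module _ {A : Set} (f : A → A) where

  iter-+ : ∀ a b x → iter f (a + b) x ≡ iter f a (iter f b x)
  iter-+ zero    b x = refl
  iter-+ (suc a) b x = cong f (iter-+ a b x)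

  iter-sucʳ : ∀ k x → iter f (suc k) x ≡ iter f k (f x)
  iter-sucʳ k x = trans (cong (λ j → iter f j x) (ℕ.+-comm 1 k)) (iter-+ k 1 x)

  iter-comm : ∀ a b x → iter f a (iter f b x) ≡ iter f b (iter f a x)
  iter-comm a b x = trans (sym (iter-+ a b x))
                          (trans (cong (λ j → iter f j x) (ℕ.+-comm a b)) (iter-+ b a x))

  iter-injective : Injective _≡_ _≡_ f → ∀ k → Injective _≡_ _≡_ (iter f k)
  iter-injective f-injective zero    eq = eq
  iter-injective f-injective (suc k) eq = iter-injective f-injective k (f-injective eq)

  iter-cancel : Injective _≡_ _≡_ f → ∀ i {k x} → iter f i x ≡ iter f (i + k) x → iter f k x ≡ x
  iter-cancel f-injective i {k} {x} eq = sym (iter-injective f-injective i (trans eq (iter-+ i k x)))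

  module _ {x : A} where

    iter-*-period : ∀ {d} → iter f d x ≡ x → ∀ c → iter f (c * d) x ≡ x
    iter-*-period         d-period zero    = refl
    iter-*-period {d = d} d-period (suc c) =
      trans (iter-+ d (c * d) x) (trans (cong (iter f d) (iter-*-period d-period c)) d-period)

    iter-∸-period : ∀ {a b} → iter f (b + a) x ≡ x → iter f a x ≡ x → iter f b x ≡ x
    iter-∸-period {a} {b} b+a-period a-period =
      trans (cong (iter f b) (sym a-period)) (trans (sym (iter-+ b a x)) b+a-period)

    iter-gcd-period : ∀ {a b} → iter f a x ≡ x → iter f b x ≡ x → iter f (gcd a b) x ≡ x
    iter-gcd-period {a} {b} a-period b-period with Bézout.identity (gcd-GCD a b)
    ... | Bézout.+- u v g+vb≡ua = iter-∸-period {a = v * b} {b = gcd a b}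
            (trans (cong (λ j → iter f j x) g+vb≡ua) (iter-*-period a-period u))
            (iter-*-period b-period v)
    ... | Bézout.-+ u v g+ua≡vb = iter-∸-period {a = u * a} {b = gcd a b}
            (trans (cong (λ j → iter f j x) g+ua≡vb) (iter-*-period b-period v))
            (iter-*-period a-period u)

    reduce-mod-period : ∀ {d} .{{_ : NonZero d}} → iter f d x ≡ x →
                        ∀ k → ∃ λ (r : Fin d) → iter f (toℕ r) x ≡ iter f k x
    reduce-mod-period {d} d-period k with result q r k≡r+qd ← k divMod d = r , (begin
      iter f (toℕ r) x                 ≡⟨ cong (iter f (toℕ r)) (iter-*-period d-period q) ⟨
      iter f (toℕ r) (iter f (q * d) x) ≡⟨ iter-+ (toℕ r) (q * d) x ⟨
      iter f (toℕ r + q * d) x          ≡⟨ cong (λ j → iter f j x) k≡r+qd ⟨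
      iter f k x                        ∎)
      where open ≡-Reasoning

¬2∣⇒coprime[2] : ∀ {d} → ¬ 2 ∣ d → Coprime d 2
¬2∣⇒coprime[2] 2∤d (e∣d , e∣2) with irreducible[2] e∣2
... | inj₁ e≡1 = e≡1
... | inj₂ refl = contradiction e∣d 2∤d

∣2^[1+m]⇒∣2^m⊎≡ : ∀ m {d} → d ∣ 2 ^ suc m → d ∣ 2 ^ m ⊎ d ≡ 2 ^ suc m
∣2^[1+m]⇒∣2^m⊎≡ m {d} d∣2^[1+m] with 2 ∣? d
... | no 2∤d = inj₁ (coprime-divisor (¬2∣⇒coprime[2] 2∤d) d∣2^[1+m])
... | yes (divides e refl) = halve m (*-cancelʳ-∣ 2 (subst (e * 2 ∣_) (ℕ.*-comm 2 (2 ^ m)) d∣2^[1+m]))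
  where
  halve : ∀ m → e ∣ 2 ^ m → e * 2 ∣ 2 ^ m ⊎ e * 2 ≡ 2 ^ suc m
  halve zero    e∣1 = inj₂ (cong (_* 2) (∣1⇒≡1 e∣1))
  halve (suc k) e∣2^[1+k] with ∣2^[1+m]⇒∣2^m⊎≡ k e∣2^[1+k]
  ... | inj₁ e∣2^k = inj₁ (subst (e * 2 ∣_) (ℕ.*-comm (2 ^ k) 2) (*-monoˡ-∣ 2 e∣2^k))
  ... | inj₂ refl  = inj₂ (ℕ.*-comm (2 ^ suc k) 2)

Period : ∀ {A : Set} → (A → A) → ℕ → Set
Period f k = ∀ x → iter f k x ≡ x

HasOrder : ∀ {A : Set} → (A → A) → ℕ → Set
HasOrder f N = Period f N × (∀ k → 0 < k → k < N → ¬ Period f k)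

NoPeriodBelow : ∀ {A : Set} → (A → A) → ℕ → A → Set
NoPeriodBelow f N x = ∀ {d} → 0 < d → d < N → iter f d x ≢ x

InjectiveBelow : ∀ {A : Set} → ℕ → (ℕ → A) → Set
InjectiveBelow N g = ∀ i j → i < N → j < N → g i ≡ g j → i ≡ j

<-distinct⇒injectiveBelow : ∀ {A : Set} {N} (g : ℕ → A) →
  (∀ {i j} → i < j → j < N → g i ≢ g j) → InjectiveBelow N g
<-distinct⇒injectiveBelow g distinct i j i<N j<N gi≡gj with ℕ.<-cmp i j
... | tri< i<j _ _ = contradiction gi≡gj (distinct i<j j<N)
... | tri≈ _ i≡j _ = i≡j
... | tri> _ _ j<i = contradiction (sym gi≡gj) (distinct j<i i<N)

module _ {A : Set} {f : A → A} where

  period⇒injective : ∀ {N} → 0 < N → Period f N → Injective _≡_ _≡_ f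
  period⇒injective {suc M} _ N-period {a} {b} fa≡fb = begin
    a                ≡⟨ N-period a ⟨
    iter f (suc M) a ≡⟨ iter-sucʳ f M a ⟩
    iter f M (f a)   ≡⟨ cong (iter f M) fa≡fb ⟩
    iter f M (f b)   ≡⟨ iter-sucʳ f M b ⟨
    iter f (suc M) b ≡⟨ N-period b ⟩
    b                ∎
    where open ≡-Reasoning

  collision⇒period : Injective _≡_ _≡_ f → ∀ {i j x} → i ≤ j →
                     iter f i x ≡ iter f j x → iter f (j ∸ i) x ≡ x
  collision⇒period f-injective {i} {j} {x} i≤j eq =
    iter-cancel f f-injective i (trans eq (cong (λ k → iter f k x) (sym (ℕ.m+[n∸m]≡n i≤j))))

  noPeriodBelow-2^[1+m] : ∀ m {x} → iter f (2 ^ suc m) x ≡ x → iter f (2 ^ m) x ≢ x →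
                          NoPeriodBelow f (2 ^ suc m) x
  noPeriodBelow-2^[1+m] m {x} N-period 2^m-nonperiod {d} 0<d d<N d-period
    -- gcd d 2^(m+1) is a period of x that divides 2^(m+1) and is at most d.
    with ∣2^[1+m]⇒∣2^m⊎≡ m (gcd[m,n]∣n d (2 ^ suc m))
  ... | inj₁ (divides c 2^m≡cg) = 2^m-nonperiod (subst (λ k → iter f k x ≡ x) (sym 2^m≡cg)
          (iter-*-period f (iter-gcd-period f {a = d} {b = 2 ^ suc m} d-period N-period) c))
  ... | inj₂ g≡N = ℕ.<-irrefl g≡N (ℕ.≤-<-trans (∣⇒≤ {{ℕ.>-nonZero 0<d}} (gcd[m,n]∣m d _)) d<N)

-- Single cycles

module _ {n : ℕ} {S : Point n → Point n} where

  cycle-covers : ∀ {x} → InjectiveBelow (2 ^ n) (λ i → iter S i x) →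
                 ∀ y → ∃ λ (i : Fin (2 ^ n)) → iter S (toℕ i) x ≡ y
  cycle-covers {x} distinct = injective⇒surjective ↔-refl (λ i → iter S (toℕ i) x)
    λ eq → Fin.toℕ-injective (distinct _ _ (Fin.toℕ<n _) (Fin.toℕ<n _) eq)

  denseOrbit⇒period≥ : ∀ {x d} → DenseOrbit S x → 0 < d → iter S d x ≡ x → 2 ^ n ≤ d
  denseOrbit⇒period≥ {x} dense 0<d d-period = surjective⇒≤ (λ r → iter S (toℕ r) x) λ y →
    let k , Skx≡y = dense y
        r , Srx≡Skx = reduce-mod-period S {{ℕ.>-nonZero 0<d}} d-period k
    in r , trans Srx≡Skx Skx≡y

  noPeriodBelow⇒singleCycle : Injective _≡_ _≡_ S → ∀ x → NoPeriodBelow S (2 ^ n) x →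
                              SingleCycle S
  noPeriodBelow⇒singleCycle S-injective x no-period =
    x , distinct , returns (toℕ i) (Fin.toℕ<n i) Six≡SNx
    where
    distinct : InjectiveBelow (2 ^ n) (λ i → iter S i x)
    distinct = <-distinct⇒injectiveBelow _ λ {i} {j} i<j j<N Six≡Sjx →
      no-period (ℕ.m<n⇒0<n∸m i<j) (ℕ.≤-<-trans (ℕ.m∸n≤m j i) j<N)
                (collision⇒period S-injective (ℕ.<⇒≤ i<j) Six≡Sjx)

    returns : ∀ k → k < 2 ^ n → iter S k x ≡ iter S (2 ^ n) x → iter S (2 ^ n) x ≡ x
    returns zero    _   x≡SNx   = sym x≡SNx
    returns (suc k) k<N Skx≡SNx =
      contradiction (collision⇒period S-injective (ℕ.<⇒≤ k<N) Skx≡SNx)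
                    (no-period (ℕ.m<n⇒0<n∸m k<N) (ℕ.∸-monoʳ-< ℕ.z<s (ℕ.<⇒≤ k<N)))

    i = proj₁ (cycle-covers distinct (iter S (2 ^ n) x))
    Six≡SNx = proj₂ (cycle-covers distinct (iter S (2 ^ n) x))

  singleCycle⇒period : SingleCycle S → Period S (2 ^ n)
  singleCycle⇒period (x , distinct , returns) y
    with i , refl ← cycle-covers distinct y =
    trans (iter-comm S (2 ^ n) (toℕ i) x) (cong (iter S (toℕ i)) returns)

  singleCycle⇒hasOrder : SingleCycle S → HasOrder S (2 ^ n)
  singleCycle⇒hasOrder sc@(x , distinct , _) = singleCycle⇒period sc , λ k 0<k k<N k-period →
    ℕ.<-irrefl (sym (distinct k 0 k<N (ℕ.m^n>0 2 n) (k-period x))) 0<k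

  singleCycle⇒minimal : SingleCycle S → Minimal S
  singleCycle⇒minimal sc@(x , distinct , returns) x′ y
    with a , refl ← cycle-covers distinct x′ | b , refl ← cycle-covers distinct y =
    toℕ b + (2 ^ n ∸ toℕ a) , (begin
      iter S (toℕ b + (2 ^ n ∸ toℕ a)) (iter S (toℕ a) x) ≡⟨ iter-+ S (toℕ b) _ _ ⟩
      iter S (toℕ b) (iter S (2 ^ n ∸ toℕ a) (iter S (toℕ a) x))
        ≡⟨ cong (iter S (toℕ b)) (iter-+ S (2 ^ n ∸ toℕ a) (toℕ a) x) ⟨
      iter S (toℕ b) (iter S (2 ^ n ∸ toℕ a + toℕ a) x)
        ≡⟨ cong (λ k → iter S (toℕ b) (iter S k x)) (ℕ.m∸n+n≡m (ℕ.<⇒≤ (Fin.toℕ<n a))) ⟩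
      iter S (toℕ b) (iter S (2 ^ n) x) ≡⟨ cong (iter S (toℕ b)) returns ⟩
      iter S (toℕ b) x                  ∎)
    where open ≡-Reasoning

  minimal⇒surjective : Minimal S → StrictlySurjective _≡_ S
  minimal⇒surjective minimal y = let k , Sk[Sy]≡y = minimal (S y) y in
    iter S k y , trans (iter-sucʳ S k y) Sk[Sy]≡y

  minimal⇒singleCycle : Minimal S → SingleCycle S
  minimal⇒singleCycle minimal =
    noPeriodBelow⇒singleCycle (surjective⇒injective S (minimal⇒surjective minimal)) x
      λ 0<d d<N d-period → ℕ.<⇒≱ d<N (denseOrbit⇒period≥ (minimal x) 0<d d-period)
    where x = replicate n false

hasOrder⇒singleCycle : ∀ {n} {S : Point n → Point n} → 1 ≤ n → HasOrder S (2 ^ n) → SingleCycle S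
hasOrder⇒singleCycle {suc k} {S} _ (N-period , no-smaller-period) =
  noPeriodBelow⇒singleCycle S-injective x (noPeriodBelow-2^[1+m] k (N-period x) S^2^k[x]≢x)
  where
  S-injective = period⇒injective (ℕ.m^n>0 2 (suc k)) N-period
  2^k-nonperiod = no-smaller-period (2 ^ k) (ℕ.m^n>0 2 k) (ℕ.^-monoʳ-< 2 (ℕ.n<1+n 1) (ℕ.n<1+n k))
  x = proj₁ (¬∀⇒∃¬ (λ x → iter S (2 ^ k) x ≟ x) 2^k-nonperiod)
  S^2^k[x]≢x = proj₂ (¬∀⇒∃¬ (λ x → iter S (2 ^ k) x ≟ x) 2^k-nonperiod)

-- Substitutions and their dual maps

^S-comm : ∀ {n} (σ : Subst n) k t → app (σ ^S k) (app σ t) ≈F app σ (app (σ ^S k) t)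
^S-comm σ zero    t p = refl
^S-comm σ (suc k) t   = Subst.cong σ (^S-comm σ k t)

periodic⇒invertible : ∀ {n} {σ : Subst n} {N} → 0 < N → (σ ^S N) ≈S idS → Invertible σ
periodic⇒invertible {σ = σ} {suc M} _ σᴺ≈id =
  σ ^S M , (λ t p → trans (^S-comm σ M t p) (σᴺ≈id t p)) , σᴺ≈id

module _ {n} {σ : Subst n} {S : Point n → Point n} (dual : IsDual σ S) where

  dual-^S : ∀ k t p → app (σ ^S k) t p ≡ t (iter S k p)
  dual-^S zero    t p = refl
  dual-^S (suc k) t p = begin
    app σ (app (σ ^S k) t) p ≡⟨ dual p (app (σ ^S k) t) ⟨
    app (σ ^S k) t (S p)     ≡⟨ dual-^S k t (S p) ⟩
    t (iter S k (S p))       ≡⟨ cong t (iter-sucʳ S k p) ⟨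
    t (iter S (suc k) p)     ∎
    where open ≡-Reasoning

  ^S≈id⇔period : ∀ k → (σ ^S k) ≈S idS ⇔ Period S k
  ^S≈id⇔period k = mk⇔
    (λ σᵏ≈id p → sym (⁅⁆-true⇒≡
       (trans (sym (dual-^S k ⁅ p ⁆ p)) (trans (σᵏ≈id ⁅ p ⁆ p) (⁅⁆-self p)))))
    (λ k-period t p → trans (dual-^S k t p) (cong t (k-period p)))

  generatedGroupOrder⇔hasOrder : ∀ N → GeneratedGroupOrder σ N ⇔ HasOrder S N
  generatedGroupOrder⇔hasOrder N = mk⇔
    (λ (σᴺ≈id , no-smaller) → to (^S≈id⇔period N) σᴺ≈id ,
       λ k 0<k k<N → no-smaller k 0<k k<N ∘ from (^S≈id⇔period k))
    (λ (N-period , no-smaller) → from (^S≈id⇔period N) N-period ,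
       λ k 0<k k<N → no-smaller k 0<k k<N ∘ to (^S≈id⇔period k))
    where open Equivalence

  singleCycle⇔invertible×order : 1 ≤ n → SingleCycle S ⇔ (Invertible σ × GeneratedGroupOrder σ (2 ^ n))
  singleCycle⇔invertible×order 1≤n = mk⇔
    (λ sc → let order = from (generatedGroupOrder⇔hasOrder (2 ^ n)) (singleCycle⇒hasOrder sc) in
            periodic⇒invertible (ℕ.m^n>0 2 n) (proj₁ order) , order)
    (λ (_ , order) → hasOrder⇒singleCycle 1≤n (to (generatedGroupOrder⇔hasOrder (2 ^ n)) order))
    where open Equivalence

-- Sums and measures

sumℚ-++ : (xs ys : List ℚ) → sumℚ (xs ++ ys) ≡ sumℚ xs ℚ.+ sumℚ ys
sumℚ-++ []       ys = sym (ℚ.+-identityˡ (sumℚ ys))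
sumℚ-++ (x ∷ xs) ys = trans (cong (x ℚ.+_) (sumℚ-++ xs ys)) (sym (ℚ.+-assoc x _ _))

sumℚ-↭ : {xs ys : List ℚ} → xs ↭ ys → sumℚ xs ≡ sumℚ ys
sumℚ-↭ {xs} {ys} xs↭ys = begin
  sumℚ xs             ≡⟨ sumℚ≗foldr xs ⟩
  foldr ℚ._+_ 0ℚ xs  ≡⟨ foldr-commMonoid (setoid ℚ) ℚ.+-0-isCommutativeMonoid (↭⇒↭ₛ xs↭ys) ⟩
  foldr ℚ._+_ 0ℚ ys  ≡⟨ sumℚ≗foldr ys ⟨
  sumℚ ys             ∎
  where
  open ≡-Reasoning
  sumℚ≗foldr : ∀ xs → sumℚ xs ≡ foldr ℚ._+_ 0ℚ xs
  sumℚ≗foldr []       = refl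
  sumℚ≗foldr (x ∷ xs) = cong (x ℚ.+_) (sumℚ≗foldr xs)

module _ {A : Set} where

  sumℚ-map-+ : (f g : A → ℚ) (xs : List A) →
               sumℚ (map (λ x → f x ℚ.+ g x) xs) ≡ sumℚ (map f xs) ℚ.+ sumℚ (map g xs)
  sumℚ-map-+ f g []       = refl
  sumℚ-map-+ f g (x ∷ xs) = trans (cong ((f x ℚ.+ g x) ℚ.+_) (sumℚ-map-+ f g xs))
                                  (interchange (f x) (g x) _ _)
    where open CommutativeSemigroupProperties (CommutativeMonoid.commutativeSemigroup ℚ.+-0-commutativeMonoid)

  sumℚ-map-0 : {f : A → ℚ} → (∀ x → f x ≡ 0ℚ) → (xs : List A) → sumℚ (map f xs) ≡ 0ℚ
  sumℚ-map-0 f≡0 []       = refl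
  sumℚ-map-0 f≡0 (x ∷ xs) = cong₂ ℚ._+_ (f≡0 x) (sumℚ-map-0 f≡0 xs)

  module _ {f : A → ℚ} (f≥0 : ∀ x → 0ℚ ℚ.≤ f x) where

    sumℚ-map-nonNeg : (xs : List A) → 0ℚ ℚ.≤ sumℚ (map f xs)
    sumℚ-map-nonNeg []       = ℚ.≤-refl
    sumℚ-map-nonNeg (x ∷ xs) = ℚ.+-mono-≤ (f≥0 x) (sumℚ-map-nonNeg xs)

    ∈⇒≤sumℚ-map : ∀ {x xs} → x ∈ xs → f x ℚ.≤ sumℚ (map f xs)
    ∈⇒≤sumℚ-map {x} (here {xs = xs} refl) = begin
      f x                       ≡⟨ ℚ.+-identityʳ (f x) ⟨
      f x ℚ.+ 0ℚ                ≤⟨ ℚ.+-monoʳ-≤ (f x) (sumℚ-map-nonNeg xs) ⟩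
      f x ℚ.+ sumℚ (map f xs)   ∎
      where open ℚ.≤-Reasoning
    ∈⇒≤sumℚ-map {x} (there {y} {ys} x∈ys) = begin
      f x                       ≤⟨ ∈⇒≤sumℚ-map x∈ys ⟩
      sumℚ (map f ys)           ≡⟨ ℚ.+-identityˡ _ ⟨
      0ℚ ℚ.+ sumℚ (map f ys)    ≤⟨ ℚ.+-monoˡ-≤ _ (f≥0 y) ⟩
      f y ℚ.+ sumℚ (map f ys)   ∎
      where open ℚ.≤-Reasoning

sumℚ-allPoints-suc : ∀ n (f : Point (suc n) → ℚ) →
  sumℚ (map f (allPoints (suc n))) ≡
  sumℚ (map (f ∘ (true ∷_)) (allPoints n)) ℚ.+ sumℚ (map (f ∘ (false ∷_)) (allPoints n))
sumℚ-allPoints-suc n f = begin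
  sumℚ (map f (map (true ∷_) ps ++ map (false ∷_) ps))
    ≡⟨ cong sumℚ (map-++ f (map (true ∷_) ps) _) ⟩
  sumℚ (map f (map (true ∷_) ps) ++ map f (map (false ∷_) ps))
    ≡⟨ sumℚ-++ (map f (map (true ∷_) ps)) _ ⟩
  sumℚ (map f (map (true ∷_) ps)) ℚ.+ sumℚ (map f (map (false ∷_) ps))
    ≡⟨ cong₂ ℚ._+_ (cong sumℚ (map-∘ ps)) (cong sumℚ (map-∘ ps)) ⟨
  sumℚ (map (f ∘ (true ∷_)) ps) ℚ.+ sumℚ (map (f ∘ (false ∷_)) ps) ∎
  where
  open ≡-Reasoning
  ps = allPoints n

module _ {n} {S : Point n → Point n}
         (S-injective : Injective _≡_ _≡_ S) (S-surjective : StrictlySurjective _≡_ S) where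

  allPoints-↭ : allPoints n ↭ map S (allPoints n)
  allPoints-↭ =
    ∼bag⇒↭ (unique∧set⇒bag (allPoints-unique n) (Unique.map⁺ S-injective (allPoints-unique n))
      λ {y} → mk⇔ (λ _ → let z , Sz≡y = S-surjective y in subst (_∈ _) Sz≡y (∈-map⁺ S (∈-allPoints z)))
                  (λ _ → ∈-allPoints y))

  sumℚ-map-∘-bijection : ∀ (f : Point n → ℚ) →
                         sumℚ (map (f ∘ S) (allPoints n)) ≡ sumℚ (map f (allPoints n))
  sumℚ-map-∘-bijection f =
    trans (cong sumℚ (map-∘ (allPoints n))) (sumℚ-↭ (↭-map⁺ f (↭-sym allPoints-↭)))

  measureBy-invariant : ∀ {m : Point n → ℚ} → (∀ p → m (S p) ≡ m p) →
                        ∀ A → measureBy m (preimage S A) ≡ measureBy m A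
  measureBy-invariant {m} m∘S≗m A =
    trans (cong sumℚ (map-cong (λ p → cong (if A (S p) then_else 0ℚ) (sym (m∘S≗m p))) (allPoints n)))
          (sumℚ-map-∘-bijection (λ q → if A q then m q else 0ℚ))

module _ {n} (m : Point n → ℚ) where

  measureBy-cong : ∀ {A B : Subset n} → (∀ p → A p ≡ B p) → measureBy m A ≡ measureBy m B
  measureBy-cong A≗B =
    cong sumℚ (map-cong (λ p → cong (if_then m p else 0ℚ) (A≗B p)) (allPoints n))

  measureBy-null : ∀ {A : Subset n} → (∀ p → A p ≡ true → m p ≡ 0ℚ) → measureBy m A ≡ 0ℚ
  measureBy-null {A} null = sumℚ-map-0 term≡0 (allPoints n)
    where
    term≡0 : ∀ p → (if A p then m p else 0ℚ) ≡ 0ℚ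
    term≡0 p with A p in Ap
    ... | true  = null p Ap
    ... | false = refl

  measureBy-complement : ∀ A → measureBy m A ℚ.+ measureBy m (not ∘ A) ≡ sumℚ (map m (allPoints n))
  measureBy-complement A =
    trans (sym (sumℚ-map-+ _ _ (allPoints n))) (cong sumℚ (map-cong split (allPoints n)))
    where
    split : ∀ p → (if A p then m p else 0ℚ) ℚ.+ (if not (A p) then m p else 0ℚ) ≡ m p
    split p with A p
    ... | true  = ℚ.+-identityʳ (m p)
    ... | false = ℚ.+-identityˡ (m p)

  measureBy-⁅⁆∩ : ∀ p (B : Subset n) →
                  measureBy m (⁅ p ⁆ ∩ B) ≡ (if B p then measureBy m ⁅ p ⁆ else 0ℚ)
  measureBy-⁅⁆∩ p B = trans (measureBy-cong (⁅⁆-∩ p B)) (by-cases (B p))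
    where
    by-cases : ∀ b → measureBy m (λ q → ⁅ p ⁆ q ∧ b) ≡ (if b then measureBy m ⁅ p ⁆ else 0ℚ)
    by-cases true  = measureBy-cong λ q → Bool.∧-identityʳ (⁅ p ⁆ q)
    by-cases false = measureBy-null λ q p∧false → contradiction (trans (sym p∧false) (Bool.∧-zeroʳ _)) λ ()

  mass≤measureBy : (∀ p → 0ℚ ℚ.≤ m p) → ∀ {A p} → A p ≡ true → m p ℚ.≤ measureBy m A
  mass≤measureBy m≥0 {A} {p} Ap =
    subst (ℚ._≤ measureBy m A) (cong (if_then m p else 0ℚ) Ap) (∈⇒≤sumℚ-map term≥0 (∈-allPoints p))
    where
    term≥0 : ∀ q → 0ℚ ℚ.≤ (if A q then m q else 0ℚ)
    term≥0 q with A q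
    ... | true  = m≥0 q
    ... | false = ℚ.≤-refl

halves : ∀ d .{{_ : NonZero d}} .{{_ : NonZero (2 * d)}} →
         + 1 / (2 * d) ℚ.+ + 1 / (2 * d) ≡ + 1 / d
halves zero {{d≢0}} = ⊥-elim-irr (NonZero.nonZero d≢0)
halves (suc a) = ℚ.toℚᵘ-injective (begin
  toℚᵘ (h ℚ.+ h)            ≈⟨ ℚ.toℚᵘ-homo-+ h h ⟩
  toℚᵘ h ℚᵘ.+ toℚᵘ h        ≈⟨ ℚᵘ.+-cong (ℚ.toℚᵘ-fromℚᵘ u) (ℚ.toℚᵘ-fromℚᵘ u) ⟩
  u ℚᵘ.+ u                  ≈⟨ *≡* (cross-multiplied _ (+ suc a) (ℤ.pos-* 2 (suc a))) ⟩
  mkℚᵘ (+ 1) a              ≈⟨ ℚ.toℚᵘ-fromℚᵘ (mkℚᵘ (+ 1) a) ⟨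
  toℚᵘ (+ 1 / suc a)        ∎)
  where
  open ℚᵘ.≃-Reasoning
  u = mkℚᵘ (+ 1) (ℕ.pred (2 * suc a))
  h = fromℚᵘ u
  cross-multiplied : ∀ d s → d ≡ + 2 ℤ.* s →
                     (+ 1 ℤ.* d ℤ.+ + 1 ℤ.* d) ℤ.* s ≡ + 1 ℤ.* (d ℤ.* d)
  cross-multiplied _ s refl = identity s
    where
    identity : ∀ s → (+ 1 ℤ.* (+ 2 ℤ.* s) ℤ.+ + 1 ℤ.* (+ 2 ℤ.* s)) ℤ.* s ≡
                     + 1 ℤ.* ((+ 2 ℤ.* s) ℤ.* (+ 2 ℤ.* s))
    identity = solve-∀

uniformMass : ℕ → ℚ
uniformMass n = _/_ (+ 1) (2 ^ n) {{ℕ.m^n≢0 2 n}}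

uniformMass>0 : ∀ n → 0ℚ ℚ.< uniformMass n
uniformMass>0 n = ℚ.positive⁻¹ _ {{ℚ.normalize-pos 1 (2 ^ n) {{ℕ.m^n≢0 2 n}}}}

-- Generalised over k so that the induction hypothesis is used at k + 1.
sumℚ-uniformMass : ∀ n k → sumℚ (map (λ _ → uniformMass (n + k)) (allPoints n)) ≡ uniformMass k
sumℚ-uniformMass zero    k = ℚ.+-identityʳ (uniformMass k)
sumℚ-uniformMass (suc n) k = begin
  sumℚ (map (λ _ → uniformMass (suc n + k)) (allPoints (suc n)))
    ≡⟨ sumℚ-allPoints-suc n _ ⟩
  sum (suc (n + k)) ℚ.+ sum (suc (n + k)) ≡⟨ cong (λ j → sum j ℚ.+ sum j) (ℕ.+-suc n k) ⟨
  sum (n + suc k) ℚ.+ sum (n + suc k)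
    ≡⟨ cong₂ ℚ._+_ (sumℚ-uniformMass n (suc k)) (sumℚ-uniformMass n (suc k)) ⟩
  uniformMass (suc k) ℚ.+ uniformMass (suc k)
    ≡⟨ halves (2 ^ k) {{ℕ.m^n≢0 2 k}} {{ℕ.m^n≢0 2 (suc k)}} ⟩
  uniformMass k ∎
  where
  open ≡-Reasoning
  sum : ℕ → ℚ
  sum j = sumℚ (map (λ _ → uniformMass j) (allPoints n))

uniform : ∀ n → ProbMeasure n
uniform n = record
  { mass   = λ _ → uniformMass n
  ; nonneg = λ _ → ℚ.<⇒≤ (uniformMass>0 n)
  ; total  = subst (λ j → sumℚ (map (λ _ → uniformMass j) (allPoints n)) ≡ 1ℚ)
                   (ℕ.+-identityʳ n) (sumℚ-uniformMass n 0)
  }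

uniform-algEquivλ : ∀ {n} → AlgEquivλ (uniform n)
uniform-algEquivλ = idS , (idS , (λ _ _ → refl) , (λ _ _ → refl)) , id , (λ _ _ → refl) , (λ _ → refl)

constant⇒measure≡0∨1 : ∀ {n} (μ : ProbMeasure n) {A : Subset n} {x} →
                       (∀ y → A y ≡ A x) → meas μ A ≡ 0ℚ ⊎ meas μ A ≡ 1ℚ
constant⇒measure≡0∨1 μ {A} {x} constant with A x
... | true  = inj₂ (trans (measureBy-cong (mass μ) constant) (total μ))
... | false = inj₁ (measureBy-null (mass μ) λ y Ay → contradiction (trans (sym Ay) (constant y)) λ ())

-- Admissible measures, ergodicity, genericity and minimality

Admissible : ∀ {n} → ProbMeasure n → Set
Admissible μ = ∀ ν → AlgEquivλ ν → AbsCont ν μ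

FullSupport : ∀ {n} → ProbMeasure n → Set
FullSupport μ = ∀ p → 0ℚ ℚ.< mass μ p

module FullySupported {n} (μ : ProbMeasure n) (μ-fullSupport : FullSupport μ) where

  measure>0 : ∀ {A p} → A p ≡ true → 0ℚ ℚ.< meas μ A
  measure>0 {p = p} Ap = ℚ.<-≤-trans (μ-fullSupport p) (mass≤measureBy (mass μ) (nonneg μ) Ap)

  measure<1 : ∀ {A p} → A p ≡ false → meas μ A ℚ.< 1ℚ
  measure<1 {A} {p} Ap = begin-strict
    meas μ A                          ≡⟨ ℚ.+-identityʳ _ ⟨
    meas μ A ℚ.+ 0ℚ                   <⟨ ℚ.+-monoʳ-< (meas μ A) (measure>0 (cong not Ap)) ⟩
    meas μ A ℚ.+ meas μ (not ∘ A)     ≡⟨ measureBy-complement (mass μ) A ⟩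
    sumℚ (map (mass μ) (allPoints n)) ≡⟨ total μ ⟩
    1ℚ                                ∎
    where open ℚ.≤-Reasoning

  measure≡1⇒full : ∀ {A} → meas μ A ≡ 1ℚ → ∀ p → A p ≡ true
  measure≡1⇒full {A} μA≡1 p with A p in Ap
  ... | true  = refl
  ... | false = contradiction μA≡1 (ℚ.<⇒≢ (measure<1 Ap))

  preserved⇒surjective : ∀ {S} → Preserves S μ → StrictlySurjective _≡_ S
  preserved⇒surjective {S} preserved y with any? (λ z → S z ≟ y)
  ... | yes hit  = hit
  ... | no  miss = contradiction μ⁅y⁆≡0 (ℚ.<⇒≢ (measure>0 (⁅⁆-self y)) ∘ sym)
    where
    μ⁅y⁆≡0 : meas μ ⁅ y ⁆ ≡ 0ℚ
    μ⁅y⁆≡0 = trans (sym (preserved ⁅ y ⁆))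
                   (measureBy-null (mass μ) λ z y≡Sz → contradiction (z , sym (⁅⁆-true⇒≡ y≡Sz)) miss)

uniform-fullSupport : ∀ {n} → FullSupport (uniform n)
uniform-fullSupport {n} _ = uniformMass>0 n

module Uniform {n : ℕ} = FullySupported (uniform n) uniform-fullSupport

uniform-admissible : ∀ {n} → Admissible (uniform n)
uniform-admissible {n} ν _ A λA≡0 = measureBy-null (mass ν) λ p Ap →
  contradiction (sym λA≡0) (ℚ.<⇒≢ (Uniform.measure>0 {n} Ap))

admissible⇒fullSupport : ∀ {n} (μ : ProbMeasure n) → Admissible μ → FullSupport μ
admissible⇒fullSupport {n} μ admissible p = ℚ.≰⇒> λ mass≤0 →
  let μ⁅p⁆≡0 = measureBy-null (mass μ) λ q ⁅p⁆q → subst (λ r → mass μ r ≡ 0ℚ) (⁅⁆-true⇒≡ ⁅p⁆q)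
                 (ℚ.≤-antisym mass≤0 (nonneg μ p))
  in ℚ.<⇒≢ (Uniform.measure>0 {n} (⁅⁆-self p))
           (sym (admissible (uniform n) uniform-algEquivλ ⁅ p ⁆ μ⁅p⁆≡0))

module _ {n} {S : Point n → Point n} where

  minimal⇒generic : Minimal S → Generic S
  minimal⇒generic minimal μ _ = (λ _ → true) , (λ p → mk⇔ (λ _ → minimal p) (λ _ → refl)) , total μ

  generic⇒minimal : Generic S → Minimal S
  generic⇒minimal generic x =
    let B , B⇔dense , λB≡1 = generic (uniform n) uniform-algEquivλ
    in Equivalence.to (B⇔dense x) (Uniform.measure≡1⇒full {n} λB≡1 x)

  minimal∧invariant⇒constant : Minimal S → ∀ {A : Subset n} → (∀ p → A (S p) ≡ A p) →
                               ∀ x y → A y ≡ A x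
  minimal∧invariant⇒constant minimal {A} invariant x y =
    let k , Skx≡y = minimal x y in trans (cong A (sym Skx≡y)) (along-orbit k)
    where
    along-orbit : ∀ k → A (iter S k x) ≡ A x
    along-orbit zero    = refl
    along-orbit (suc k) = trans (invariant (iter S k x)) (along-orbit k)

  minimal⇒ergodic : Minimal S → Ergodic S
  minimal⇒ergodic minimal = uniform n , uniform-admissible , uniform-preserved , λ A invariant →
    constant⇒measure≡0∨1 (uniform n) (minimal∧invariant⇒constant minimal invariant (replicate n false))
    where
    uniform-preserved : Preserves S (uniform n)
    uniform-preserved = measureBy-invariant (surjective⇒injective S (minimal⇒surjective minimal))
                                            (minimal⇒surjective minimal) (λ _ → refl)

module _ {n} {S : Point n → Point n} (S-injective : Injective _≡_ _≡_ S) where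

  injective⇒periodic : ∀ x → ∃ λ P → iter S (suc P) x ≡ x
  injective⇒periodic x =
    let i , j , i<j , Six≡Sjx = pigeonhole (λ k → iter S k x)
        P , 1+i+P≡j = ℕ.m≤n⇒∃[o]m+o≡n i<j
    in P , iter-cancel S S-injective i {k = suc P}
             (trans Six≡Sjx (cong (λ k → iter S k x) (trans (sym 1+i+P≡j) (sym (ℕ.+-suc i P)))))

  module Orbit {x : Point n} {P : ℕ} (period : iter S (suc P) x ≡ x) where

    Reaches : Point n → Set
    Reaches y = ∃ λ k → iter S k x ≡ y

    reaches? : Decidable Reaches
    reaches? y = Dec.map′ (λ (r , Srx≡y) → toℕ r , Srx≡y)
                          (λ (k , Skx≡y) → let r , Srx≡Skx = reduce-mod-period S {d = suc P} period k in
                                           r , trans Srx≡Skx Skx≡y)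
                          (Fin.any? λ r → iter S (toℕ r) x ≟ y)

    reaches-S⇔reaches : ∀ y → Reaches (S y) ⇔ Reaches y
    reaches-S⇔reaches y = mk⇔ backward (λ (k , Skx≡y) → suc k , cong S Skx≡y)
      where
      backward : Reaches (S y) → Reaches y
      backward (zero  , x≡Sy)      = P , S-injective (trans period x≡Sy)
      backward (suc k , S[Skx]≡Sy) = k , S-injective S[Skx]≡Sy

    orbit : Subset n
    orbit y = does (reaches? y)

    orbit-invariant : ∀ y → orbit (S y) ≡ orbit y
    orbit-invariant y = does-⇔ (reaches-S⇔reaches y) (reaches? (S y)) (reaches? y)

ergodic⇒minimal : ∀ {n} {S : Point n → Point n} → Ergodic S → Minimal S
ergodic⇒minimal {n} {S} (μ , admissible , preserved , ergodic) x y =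
  [ (λ μO≡0 → contradiction (sym μO≡0) (ℚ.<⇒≢ (measure>0 x∈orbit)))
  , (λ μO≡1 → does-true⇒ (reaches? y) (measure≡1⇒full μO≡1 y))
  ]′ (ergodic orbit orbit-invariant)
  where
  open FullySupported μ (admissible⇒fullSupport μ admissible)
  S-injective = surjective⇒injective S (preserved⇒surjective preserved)
  periodic = injective⇒periodic S-injective x
  open Orbit S-injective {P = proj₁ periodic} (proj₂ periodic)
  x∈orbit : orbit x ≡ true
  x∈orbit = dec-true (reaches? x) (0 , refl)

-- Exactness and mixing

limit-of-two-valued : ∀ {a : ℕ → ℚ} {u v L} → (∀ k → a k ≡ u ⊎ a k ≡ v) →
                      Converges a L → L ≡ u ⊎ L ≡ v
limit-of-two-valued {a} {u} {v} {L} two-valued a→L with L ℚ.≟ u | L ℚ.≟ v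
... | yes L≡u | _       = inj₁ L≡u
... | no  _   | yes L≡v = inj₂ L≡v
... | no  L≢u | no  L≢v = ⊥-elim (
  [ (λ aₖ≡u → ℚ.<-irrefl (cong dist aₖ≡u) (close-u k (ℕ.m≤m+n Nu Nv)))
  , (λ aₖ≡v → ℚ.<-irrefl (cong dist aₖ≡v) (close-v k (ℕ.m≤n+m Nv Nu)))
  ]′ (two-valued k))
  where
  dist : ℚ → ℚ
  dist x = ℚ.∣ x ℚ.- L ∣
  dist>0 : ∀ {x} → L ≢ x → 0ℚ ℚ.< dist x
  dist>0 {x} L≢x = ℚ.≰⇒> λ dist≤0 → L≢x (sym (x-y≡0⇒x≡y x L
    (ℚ.∣p∣≡0⇒p≡0 _ (ℚ.≤-antisym dist≤0 (ℚ.0≤∣p∣ _)))))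
    where open GroupProperties ℚ.+-0-group using () renaming (x∙y⁻¹≈ε⇒x≈y to x-y≡0⇒x≡y)
  Nu = proj₁ (a→L (dist u) (dist>0 L≢u))
  close-u = proj₂ (a→L (dist u) (dist>0 L≢u))
  Nv = proj₁ (a→L (dist v) (dist>0 L≢v))
  close-v = proj₂ (a→L (dist v) (dist>0 L≢v))
  k = Nu + Nv

module _ {n} {S : Point n → Point n} (1≤n : 1 ≤ n) where

  private
    p = replicate n false

  ¬exact : ¬ Exact S
  ¬exact (μ , admissible , preserved , exact) =
    [ (λ μp≡0 → ℚ.<⇒≢ (measure>0 (⁅⁆-self p)) (sym μp≡0))
    , (λ μp≡1 → ℚ.<⇒≢ (measure<1 (proj₂ (⁅⁆-proper 1≤n p))) μp≡1)
    ]′ (exact ⁅ p ⁆ λ k → ⁅ iter S k p ⁆ , ⁅⁆-image (iter-injective S S-injective k) p)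
    where
    open FullySupported μ (admissible⇒fullSupport μ admissible)
    S-injective = surjective⇒injective S (preserved⇒surjective preserved)

  ¬mixing : ¬ Mixing S
  ¬mixing (μ , admissible , _ , mixing) =
    [ (λ m²≡m → ℚ.<⇒≢ m²<m m²≡m) , (λ m²≡0 → ℚ.<⇒≢ m²>0 (sym m²≡0)) ]′
    (limit-of-two-valued two-valued (mixing ⁅ p ⁆ ⁅ p ⁆))
    where
    open FullySupported μ (admissible⇒fullSupport μ admissible)
    m = meas μ ⁅ p ⁆
    m>0 : 0ℚ ℚ.< m
    m>0 = measure>0 (⁅⁆-self p)
    m<1 : m ℚ.< 1ℚ
    m<1 = measure<1 (proj₂ (⁅⁆-proper 1≤n p))
    m²>0 : 0ℚ ℚ.< m ℚ.* m
    m²>0 = ℚ.positive⁻¹ _ {{ℚ.pos*pos⇒pos m {{ℚ.positive m>0}} m {{ℚ.positive m>0}}}}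
    m²<m : m ℚ.* m ℚ.< m
    m²<m = subst (m ℚ.* m ℚ.<_) (ℚ.*-identityʳ m) (ℚ.*-monoʳ-<-pos m {{ℚ.positive m>0}} m<1)
    two-valued : ∀ k → meas μ (⁅ p ⁆ ∩ preimage (iter S k) ⁅ p ⁆) ≡ m ⊎
                       meas μ (⁅ p ⁆ ∩ preimage (iter S k) ⁅ p ⁆) ≡ 0ℚ
    two-valued k with ⁅ p ⁆ (iter S k p) | measureBy-⁅⁆∩ (mass μ) p (preimage (iter S k) ⁅ p ⁆)
    ... | true  | μ[p∩S⁻ᵏp]≡m = inj₁ μ[p∩S⁻ᵏp]≡m
    ... | false | μ[p∩S⁻ᵏp]≡0 = inj₂ μ[p∩S⁻ᵏp]≡0

proposition2p7 : (n : ℕ) → 1 ≤ n → (σ : Subst n) → (S : Point n → Point n) → IsDual σ S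
    → ¬ Exact S × ¬ Mixing S
      × (Ergodic S ⇔ Generic S) × (Generic S ⇔ Minimal S) × (Minimal S ⇔ SingleCycle S)
      × (SingleCycle S ⇔ (Invertible σ × GeneratedGroupOrder σ (2 ^ n)))
proposition2p7 n 1≤n σ S dual =
  ¬exact 1≤n , ¬mixing 1≤n ,
  mk⇔ (minimal⇒generic ∘ ergodic⇒minimal) (minimal⇒ergodic ∘ generic⇒minimal) ,
  mk⇔ generic⇒minimal minimal⇒generic ,
  mk⇔ minimal⇒singleCycle singleCycle⇒minimal ,
  singleCycle⇔invertible×order dual 1≤n
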